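{- Let $G$ and $H$ be two independent Erdős–Rényi graphs $G(n,p)$ on $n$ vertices with attachment probability $p\in(0,1)$, let $k$ be a positive integer, let $Z_k$ be the number of $k$-cliques in $G\times H$ and let $X_k$ be the number of $k$-cliques in $G$. Then $$\mathbb{E}[Z_k] = k!\binom{n}{k}^2 p^{k(k-1)},$$ and $$\mathrm{Var}(Z_k) = (k!)^2\left((\mathrm{Var}(X_k))^2 + 2\,\mathrm{Var}(X_k)\,(\mathbb{E}[X_k])^2\right).$$
   Context: An Erdős–Rényi graph $G(n,p)$ is a random simple graph on vertex set $\{1,\dots,n\}$ in which each of the $\binom{n}{2}$ possible edges is present independently with probability $p$. A $k$-clique is a set of $k$ pairwise adjacent vertices. The tensor product $G\times H$ of graphs $G=(V_1,E_1)$, $H=(V_2,E_2)$ has vertex set $V_1\times V_2$, with $(v_1,v_2)$ adjacent to $(v_1',v_2')$ if and only if $v_1v_1'\in E_1$ and $v_2v_2'\in E_2$.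
   Formalization: The attachment probability p ranges over the rationals in (0,1) instead of the reals. -}

module Defs where

open import Data.Bool using (Bool; true; false; if_then_else_; _∧_)
open import Data.Nat using (ℕ; zero; suc)
import Data.Nat as ℕ
open import Data.Integer using (+_)
open import Data.Fin using (Fin; zero; suc)
open import Data.Vec using (Vec; []; _∷_; lookup)
open import Data.List using (List; []; _∷_; map; concatMap; length; filter; allFin; cartesianProduct; foldr)
open import Data.Bool.ListAction using (and)
open import Data.Product using (_×_; _,_)
open import Data.Unit using (⊤; tt)
open import Data.Rational using (ℚ; 0ℚ; 1ℚ; _+_; _*_; _-_; _/_)
open import Relation.Nullary.Decidable using (Dec; yes; no)
open import Relation.Binary.PropositionalEquality using (_≡_)
open import Data.Bool.Properties using (_≟_)

ℕ→ℚ : ℕ → ℚ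
ℕ→ℚ n = + n / 1

_^ℚ_ : ℚ → ℕ → ℚ
x ^ℚ zero  = 1ℚ
x ^ℚ suc m = x * (x ^ℚ m)

sumℚ : List ℚ → ℚ
sumℚ = foldr _+_ 0ℚ

-- A graph on suc n vertices = adjacency row of vertex 0 to the other
-- n vertices, together with a graph on the remaining n vertices.
-- Every simple graph on Fin n has exactly one such representation
-- (one Bool per unordered pair {i,j}, i ≠ j).

Graph : ℕ → Set
Graph zero    = ⊤
Graph (suc n) = Vec Bool n × Graph n

adj : ∀ {n} → Graph n → Fin n → Fin n → Bool
adj {suc n} (r , g) zero    zero    = false
adj {suc n} (r , g) zero    (suc j) = lookup r j
adj {suc n} (r , g) (suc i) zero    = lookup r i
adj {suc n} (r , g) (suc i) (suc j) = adj g i j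

allVecs : (m : ℕ) → List (Vec Bool m)
allVecs zero    = [] ∷ []
allVecs (suc m) = concatMap (λ v → (true ∷ v) ∷ (false ∷ v) ∷ []) (allVecs m)

allGraphs : (n : ℕ) → List (Graph n)
allGraphs zero    = tt ∷ []
allGraphs (suc n) = concatMap (λ r → map (λ g → r , g) (allGraphs n)) (allVecs n)

rowWeight : ∀ {m} → ℚ → Vec Bool m → ℚ
rowWeight p []       = 1ℚ
rowWeight p (b ∷ bs) = (if b then p else (1ℚ - p)) * rowWeight p bs

prob : ℚ → ∀ {n} → Graph n → ℚ
prob p {zero}  tt      = 1ℚ
prob p {suc n} (r , g) = rowWeight p r * prob p g

𝔼₁ : ℚ → (n : ℕ) → (Graph n → ℚ) → ℚ
𝔼₁ p n f = sumℚ (map (λ g → prob p g * f g) (allGraphs n))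

𝔼₂ : ℚ → (n : ℕ) → (Graph n → Graph n → ℚ) → ℚ
𝔼₂ p n f = sumℚ (concatMap (λ g → map (λ h → prob p g * prob p h * f g h) (allGraphs n)) (allGraphs n))

Var₁ : ℚ → (n : ℕ) → (Graph n → ℚ) → ℚ
Var₁ p n f = 𝔼₁ p n (λ g → f g * f g) - (𝔼₁ p n f * 𝔼₁ p n f)

Var₂ : ℚ → (n : ℕ) → (Graph n → Graph n → ℚ) → ℚ
Var₂ p n f = 𝔼₂ p n (λ g h → f g h * f g h) - (𝔼₂ p n f * 𝔼₂ p n f)

-- For a graph given by an adjacency function on vertex type V
-- and a duplicate-free list vs enumerating V, the k-cliques are exactly
-- the length-k sublists of vs whose elements are pairwise adjacent.

sublists : ∀ {A : Set} → List A → ℕ → List (List A)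
sublists xs       zero    = [] ∷ []
sublists []       (suc k) = []
sublists (x ∷ xs) (suc k) = map (x ∷_) (sublists xs k) ++' sublists xs (suc k)
  where
  _++'_ : ∀ {B : Set} → List B → List B → List B
  [] ++' ys       = ys
  (z ∷ zs) ++' ys = z ∷ (zs ++' ys)

pairwiseAdj : ∀ {V : Set} → (V → V → Bool) → List V → Bool
pairwiseAdj a []       = true
pairwiseAdj a (x ∷ xs) = and (map (a x) xs) ∧ pairwiseAdj a xs

countCliques : ∀ {V : Set} → (V → V → Bool) → List V → ℕ → ℕ
countCliques a vs k = length (filter (λ c → pairwiseAdj a c ≟ true) (sublists vs k))

tensorAdj : ∀ {n m} → Graph n → Graph m → (Fin n × Fin m) → (Fin n × Fin m) → Bool
tensorAdj g h (v₁ , v₂) (w₁ , w₂) = adj g v₁ w₁ ∧ adj h v₂ w₂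

X : ∀ {n} → ℕ → Graph n → ℕ
X {n} k g = countCliques (adj g) (allFin n) k

Z : ∀ {n} → ℕ → Graph n → Graph n → ℕ
Z {n} k g h = countCliques (tensorAdj g h) (cartesianProduct (allFin n) (allFin n)) k

{-# OPTIONS --safe #-}
-- Counting k-cliques as ordered k-tuples of pairwise adjacent vertices multiplies their number by
-- k!, by double counting: (k+1)·#{(k+1)-cliques} = Σₓ #{k-cliques in the neighbourhood of x}.
-- An ordered clique of G × H is exactly a pair of ordered cliques of G and of H, hence
-- Z_k(G,H) = k! X_k(G) X_k(H). Independence of G and H gives E[Z_k] = k! E[X_k]² and
-- E[Z_k²] = k!² E[X_k²]², and the variance formula is then algebra. Finally E[X_k] = C(n,k) p^(k choose 2)
-- by linearity: peeling off vertex 0, whose adjacency row is independent of the rest of the graph,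
-- a k-set containing 0 is a clique iff 0 is joined to the other k−1 vertices (probability p^(k−1))
-- and these form a clique, so every k-set is a clique with probability p^(k choose 2).
module Submission where

open import Algebra.Bundles using (CommutativeSemiring)
open import Defs

module Lists where

  open import Data.Bool using (Bool; true; false; if_then_else_)
  open import Data.Fin using (Fin; zero; suc)
  open import Data.List using (List; []; _∷_; map; _++_; concatMap; filterᵇ; length; allFin; tabulate)
  open import Data.List.Properties using (map-∘; map-++; length-++; length-map; map-tabulate)
  open import Data.List.Relation.Unary.All as All using (All)
  open import Data.List.Relation.Unary.All.Properties using (++⁺; map⁺)
  open import Data.Nat using (ℕ; zero; suc; _+_)
  open import Data.Nat.Combinatorics using (_C_; nCk+nC[k+1]≡[n+1]C[k+1])
  open import Relation.Binary.PropositionalEquality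
  open ≡-Reasoning

  private variable
    A B : Set

  tuples : List A → ℕ → List (List A)
  tuples xs zero    = [] ∷ []
  tuples xs (suc k) = concatMap (λ x → map (x ∷_) (tuples xs k)) xs

  -- `sublists` appends with a copy of `_++_` local to its where-block. The meta below is solved
  -- by unification to that copy, which makes it nameable and comparable with `_++_`.
  private
    mutual
      sublistsAppend : A → List A → ℕ → List (List A) → List (List A) → List (List A)
      sublistsAppend x xs k = _

      sublists-unfold : ∀ (x : A) xs k →
        sublists (x ∷ xs) (suc k) ≡ sublistsAppend x xs k (map (x ∷_) (sublists xs k)) (sublists xs (suc k))
      sublists-unfold x xs k with map (x ∷_) (sublists xs k) | sublists xs (suc k)
      ... | _ | _ = refl

    sublistsAppend≡++ : ∀ (x : A) xs k L R → sublistsAppend x xs k L R ≡ L ++ R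
    sublistsAppend≡++ x xs k []      R = refl
    sublistsAppend≡++ x xs k (S ∷ L) R = cong (S ∷_) (sublistsAppend≡++ x xs k L R)

  sublists-∷ : ∀ (x : A) xs k →
               sublists (x ∷ xs) (suc k) ≡ map (x ∷_) (sublists xs k) ++ sublists xs (suc k)
  sublists-∷ x xs k = trans (sublists-unfold x xs k)
                            (sublistsAppend≡++ x xs k (map (x ∷_) (sublists xs k)) (sublists xs (suc k)))

  sublists-map : ∀ (f : A → B) xs k → sublists (map f xs) k ≡ map (map f) (sublists xs k)
  sublists-map f []       zero    = refl
  sublists-map f []       (suc k) = refl
  sublists-map f (x ∷ xs) zero    = refl
  sublists-map f (x ∷ xs) (suc k) = begin
    sublists (f x ∷ map f xs) (suc k)
      ≡⟨ sublists-∷ (f x) (map f xs) k ⟩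
    map (f x ∷_) (sublists (map f xs) k) ++ sublists (map f xs) (suc k)
      ≡⟨ cong₂ (λ L R → map (f x ∷_) L ++ R) (sublists-map f xs k) (sublists-map f xs (suc k)) ⟩
    map (f x ∷_) (map (map f) (sublists xs k)) ++ map (map f) (sublists xs (suc k))
      ≡⟨ cong (_++ _) (trans (sym (map-∘ (sublists xs k))) (map-∘ (sublists xs k))) ⟩
    map (map f) (map (x ∷_) (sublists xs k)) ++ map (map f) (sublists xs (suc k))
      ≡⟨ map-++ (map f) (map (x ∷_) (sublists xs k)) _ ⟨
    map (map f) (map (x ∷_) (sublists xs k) ++ sublists xs (suc k))
      ≡⟨ cong (map (map f)) (sublists-∷ x xs k) ⟨
    map (map f) (sublists (x ∷ xs) (suc k)) ∎

  length-sublists : ∀ (xs : List A) k → length (sublists xs k) ≡ length xs C k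
  length-sublists []       zero    = refl
  length-sublists []       (suc k) = refl
  length-sublists (x ∷ xs) zero    = refl
  length-sublists (x ∷ xs) (suc k) = begin
    length (sublists (x ∷ xs) (suc k))
      ≡⟨ cong length (sublists-∷ x xs k) ⟩
    length (map (x ∷_) (sublists xs k) ++ sublists xs (suc k))
      ≡⟨ length-++ (map (x ∷_) (sublists xs k)) ⟩
    length (map (x ∷_) (sublists xs k)) + length (sublists xs (suc k))
      ≡⟨ cong₂ _+_ (trans (length-map (x ∷_) (sublists xs k)) (length-sublists xs k))
                   (length-sublists xs (suc k)) ⟩
    length xs C k + length xs C suc k
      ≡⟨ nCk+nC[k+1]≡[n+1]C[k+1] (length xs) k ⟩
    suc (length xs) C suc k ∎

  sublists-allFin-suc : ∀ n k → sublists (allFin (suc n)) (suc k)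
    ≡ map (zero ∷_) (map (map suc) (sublists (allFin n) k)) ++ map (map suc) (sublists (allFin n) (suc k))
  sublists-allFin-suc n k = begin
    sublists (zero ∷ tabulate suc) (suc k)
      ≡⟨ sublists-∷ zero (tabulate suc) k ⟩
    map (zero ∷_) (sublists (tabulate suc) k) ++ sublists (tabulate suc) (suc k)
      ≡⟨ cong (λ xs → map (zero ∷_) (sublists xs k) ++ sublists xs (suc k))
              (sym (map-tabulate (λ i → i) suc)) ⟩
    map (zero ∷_) (sublists (map suc (allFin n)) k) ++ sublists (map suc (allFin n)) (suc k)
      ≡⟨ cong₂ (λ L R → map (zero ∷_) L ++ R) (sublists-map suc (allFin n) k)
                                                (sublists-map suc (allFin n) (suc k)) ⟩
    map (zero ∷_) (map (map suc) (sublists (allFin n) k)) ++ map (map suc) (sublists (allFin n) (suc k)) ∎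

  All-sublists-allFin : (P : ∀ {n} → ℕ → List (Fin n) → Set) →
    (∀ {n} → P {n} 0 []) →
    (∀ {n k S} → P {n} k S → P (suc k) (zero ∷ map suc S)) →
    (∀ {n k S} → P {n} k S → P k (map suc S)) →
    ∀ n k → All (P k) (sublists (allFin n) k)
  All-sublists-allFin P nil extend shift n       zero    = nil All.∷ All.[]
  All-sublists-allFin P nil extend shift zero    (suc k) = All.[]
  All-sublists-allFin P nil extend shift (suc n) (suc k) = subst (All (P (suc k))) (sym (sublists-allFin-suc n k))
    (++⁺ (map⁺ (map⁺ (All.map extend (All-sublists-allFin P nil extend shift n k))))
         (map⁺ (All.map shift (All-sublists-allFin P nil extend shift n (suc k)))))

  filterᵇ-∷ : ∀ (c : A → Bool) x xs →
              filterᵇ c (x ∷ xs) ≡ (if c x then x ∷ filterᵇ c xs else filterᵇ c xs)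
  filterᵇ-∷ c x xs with c x
  ... | true  = refl
  ... | false = refl

  filterᵇ-comm : ∀ (c d : A → Bool) xs → filterᵇ c (filterᵇ d xs) ≡ filterᵇ d (filterᵇ c xs)
  filterᵇ-comm c d []       = refl
  filterᵇ-comm c d (x ∷ xs) with c x in cx | d x in dx
  ... | true  | true  rewrite cx | dx = cong (x ∷_) (filterᵇ-comm c d xs)
  ... | true  | false rewrite dx = filterᵇ-comm c d xs
  ... | false | true  rewrite cx = filterᵇ-comm c d xs
  ... | false | false = filterᵇ-comm c d xs

module ListSum {c ℓ} (R : CommutativeSemiring c ℓ) where

  open import Data.List using (List; []; _∷_; map; _++_; concatMap; foldr; cartesianProduct)
  open import Data.List.Properties using (map-++; map-∘)
  open import Data.Nat using (zero; suc)
  open import Data.Product using (_×_; _,_; proj₁; proj₂)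
  open import Function using (_∘_)
  open import Relation.Binary.PropositionalEquality as ≡ using (_≡_)

  open CommutativeSemiring R
  open import Algebra.Properties.CommutativeSemigroup +-commutativeSemigroup using (interchange)
  open import Relation.Binary.Reasoning.Setoid setoid
  open Lists using (tuples)

  private variable
    A B : Set

  sum : List Carrier → Carrier
  sum = foldr _+_ 0#

  ∑ : (A → Carrier) → List A → Carrier
  ∑ f xs = sum (map f xs)

  ∑-cong : ∀ {f g : A → Carrier} → (∀ x → f x ≈ g x) → ∀ xs → ∑ f xs ≈ ∑ g xs
  ∑-cong f≈g []       = refl
  ∑-cong f≈g (x ∷ xs) = +-cong (f≈g x) (∑-cong f≈g xs)

  sum-++ : ∀ xs ys → sum (xs ++ ys) ≈ sum xs + sum ys
  sum-++ []       ys = sym (+-identityˡ (sum ys))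
  sum-++ (x ∷ xs) ys = trans (+-congˡ (sum-++ xs ys)) (sym (+-assoc x (sum xs) (sum ys)))

  ∑-++ : ∀ (f : A → Carrier) xs ys → ∑ f (xs ++ ys) ≈ ∑ f xs + ∑ f ys
  ∑-++ f xs ys = trans (reflexive (≡.cong sum (map-++ f xs ys))) (sum-++ (map f xs) (map f ys))

  ∑-map : ∀ (f : B → Carrier) (g : A → B) xs → ∑ f (map g xs) ≡ ∑ (f ∘ g) xs
  ∑-map f g xs = ≡.cong sum (≡.sym (map-∘ xs))

  sum-concatMap : ∀ (g : A → List Carrier) xs → sum (concatMap g xs) ≈ ∑ (sum ∘ g) xs
  sum-concatMap g []       = refl
  sum-concatMap g (x ∷ xs) = trans (sum-++ (g x) (concatMap g xs)) (+-congˡ (sum-concatMap g xs))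

  ∑-concatMap : ∀ (f : B → Carrier) (g : A → List B) xs → ∑ f (concatMap g xs) ≈ ∑ (∑ f ∘ g) xs
  ∑-concatMap f g []       = refl
  ∑-concatMap f g (x ∷ xs) = trans (∑-++ f (g x) (concatMap g xs)) (+-congˡ (∑-concatMap f g xs))

  ∑-zero : ∀ (xs : List A) → ∑ (λ _ → 0#) xs ≈ 0#
  ∑-zero []       = refl
  ∑-zero (x ∷ xs) = trans (+-congˡ (∑-zero xs)) (+-identityˡ 0#)

  ∑-+ : ∀ (f g : A → Carrier) xs → ∑ (λ x → f x + g x) xs ≈ ∑ f xs + ∑ g xs
  ∑-+ f g []       = sym (+-identityˡ 0#)
  ∑-+ f g (x ∷ xs) = trans (+-congˡ (∑-+ f g xs)) (interchange (f x) (g x) (∑ f xs) (∑ g xs))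

  ∑-*ˡ : ∀ a (f : A → Carrier) xs → ∑ (λ x → a * f x) xs ≈ a * ∑ f xs
  ∑-*ˡ a f []       = sym (zeroʳ a)
  ∑-*ˡ a f (x ∷ xs) = trans (+-congˡ (∑-*ˡ a f xs)) (sym (distribˡ a (f x) (∑ f xs)))

  ∑-*ʳ : ∀ a (f : A → Carrier) xs → ∑ (λ x → f x * a) xs ≈ ∑ f xs * a
  ∑-*ʳ a f []       = sym (zeroˡ a)
  ∑-*ʳ a f (x ∷ xs) = trans (+-congˡ (∑-*ʳ a f xs)) (sym (distribʳ a (f x) (∑ f xs)))

  ∑-comm : ∀ (f : A → B → Carrier) xs ys →
           ∑ (λ x → ∑ (f x) ys) xs ≈ ∑ (λ y → ∑ (λ x → f x y) xs) ys
  ∑-comm f []       ys = sym (∑-zero ys)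
  ∑-comm f (x ∷ xs) ys = begin
    ∑ (f x) ys + ∑ (λ x → ∑ (f x) ys) xs          ≈⟨ +-congˡ (∑-comm f xs ys) ⟩
    ∑ (f x) ys + ∑ (λ y → ∑ (λ x → f x y) xs) ys  ≈⟨ sym (∑-+ (f x) _ ys) ⟩
    ∑ (λ y → f x y + ∑ (λ x → f x y) xs) ys       ∎

  ∑-*-∑ : ∀ (f : A → Carrier) (g : B → Carrier) xs ys →
          ∑ (λ x → ∑ (λ y → f x * g y) ys) xs ≈ ∑ f xs * ∑ g ys
  ∑-*-∑ f g xs ys = trans (∑-cong (λ x → ∑-*ˡ (f x) g ys) xs) (∑-*ʳ (∑ g ys) f xs)

  ∑-cartesianProduct : ∀ (F : A × B → Carrier) xs ys →
                       ∑ F (cartesianProduct xs ys) ≈ ∑ (λ x → ∑ (λ y → F (x , y)) ys) xs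
  ∑-cartesianProduct F []       ys = refl
  ∑-cartesianProduct F (x ∷ xs) ys = trans (∑-++ F (map (x ,_) ys) (cartesianProduct xs ys))
                                          (+-cong (reflexive (∑-map F (x ,_) ys)) (∑-cartesianProduct F xs ys))

  ∑-tuples-suc : ∀ (F : List A → Carrier) xs k →
                 ∑ F (tuples xs (suc k)) ≈ ∑ (λ x → ∑ (F ∘ (x ∷_)) (tuples xs k)) xs
  ∑-tuples-suc F xs k =
    trans (∑-concatMap F _ xs) (∑-cong (λ x → reflexive (∑-map F (x ∷_) (tuples xs k))) xs)

  ∑-tuples-cartesianProduct : ∀ (F : List A → Carrier) (G : List B → Carrier) xs ys k →
    ∑ (λ t → F (map proj₁ t) * G (map proj₂ t)) (tuples (cartesianProduct xs ys) k)
      ≈ ∑ F (tuples xs k) * ∑ G (tuples ys k)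
  ∑-tuples-cartesianProduct F G xs ys zero =
    trans (+-identityʳ _) (sym (*-cong (+-identityʳ (F [])) (+-identityʳ (G []))))
  ∑-tuples-cartesianProduct F G xs ys (suc k) = begin
    ∑ H (tuples xys (suc k))
      ≈⟨ ∑-tuples-suc H xys k ⟩
    ∑ (λ (x , y) → ∑ (λ t → F (x ∷ map proj₁ t) * G (y ∷ map proj₂ t)) (tuples xys k)) xys
      ≈⟨ ∑-cong (λ (x , y) → ∑-tuples-cartesianProduct (F ∘ (x ∷_)) (G ∘ (y ∷_)) xs ys k) xys ⟩
    ∑ (λ (x , y) → ∑ (F ∘ (x ∷_)) (tuples xs k) * ∑ (G ∘ (y ∷_)) (tuples ys k)) xys
      ≈⟨ ∑-cartesianProduct _ xs ys ⟩
    ∑ (λ x → ∑ (λ y → ∑ (F ∘ (x ∷_)) (tuples xs k) * ∑ (G ∘ (y ∷_)) (tuples ys k)) ys) xs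
      ≈⟨ ∑-*-∑ _ _ xs ys ⟩
    ∑ (λ x → ∑ (F ∘ (x ∷_)) (tuples xs k)) xs * ∑ (λ y → ∑ (G ∘ (y ∷_)) (tuples ys k)) ys
      ≈⟨ *-cong (∑-tuples-suc F xs k) (∑-tuples-suc G ys k) ⟨
    ∑ F (tuples xs (suc k)) * ∑ G (tuples ys (suc k)) ∎
    where
    xys : List (_ × _)
    xys = cartesianProduct xs ys
    H : List (_ × _) → Carrier
    H t = F (map proj₁ t) * G (map proj₂ t)

module Cliques where

  open import Algebra.Bundles using (CommutativeMonoid)
  open import Data.Bool using (Bool; true; false; _∧_; if_then_else_)
  open import Data.Bool.ListAction using (all; and)
  open import Data.Bool.Properties using (_≟_; ∧-commutativeMonoid)
  open import Data.Fin using (zero; suc)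
  open import Data.List using (List; []; _∷_; map; _++_; filter; filterᵇ; length; cartesianProduct; allFin)
  open import Data.List.Properties using (map-∘)
  open import Data.Nat using (ℕ; zero; suc; _+_; _*_; _!)
  open import Data.Nat.Properties
    using ( +-*-commutativeSemiring; +-identityʳ; +-assoc; +-comm
          ; *-identityˡ; *-zeroʳ; *-assoc; *-distribˡ-+; *-cancelˡ-≡; _!≢0)
  open import Data.Product using (_×_; _,_; proj₁; proj₂)
  open import Function using (_∘_)
  open import Relation.Binary.PropositionalEquality
  open ≡-Reasoning

  open import Algebra.Properties.CommutativeSemigroup (CommutativeMonoid.commutativeSemigroup ∧-commutativeMonoid)
    using () renaming (interchange to ∧-interchange)
  open import Algebra.Properties.CommutativeSemigroup (CommutativeSemiring.*-commutativeSemigroup +-*-commutativeSemiring)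
    using (x∙yz≈y∙xz) renaming (interchange to *-interchange)

  open Lists
  open ListSum +-*-commutativeSemiring

  private variable
    A V W : Set

  𝟙 : Bool → ℕ
  𝟙 b = if b then 1 else 0

  𝟙-∧ : ∀ a b → 𝟙 (a ∧ b) ≡ 𝟙 a * 𝟙 b
  𝟙-∧ true  b = sym (+-identityʳ (𝟙 b))
  𝟙-∧ false b = refl

  ∑-𝟙-∧ : ∀ b (P : A → Bool) (f : A → ℕ) xs →
          ∑ (λ x → 𝟙 (b ∧ P x) * f x) xs ≡ 𝟙 b * ∑ (λ x → 𝟙 (P x) * f x) xs
  ∑-𝟙-∧ true  P f xs = sym (*-identityˡ (∑ (λ x → 𝟙 (P x) * f x) xs))
  ∑-𝟙-∧ false P f xs = ∑-zero xs

  ∑-filterᵇ : ∀ (c : A → Bool) (f : A → ℕ) xs →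
              ∑ f (filterᵇ c xs) ≡ ∑ (λ x → 𝟙 (c x) * f x) xs
  ∑-filterᵇ c f []       = refl
  ∑-filterᵇ c f (x ∷ xs) with c x
  ... | true  = cong₂ _+_ (sym (*-identityˡ (f x))) (∑-filterᵇ c f xs)
  ... | false = ∑-filterᵇ c f xs

  ∑-sublists-∷ : ∀ (f : List A → ℕ) x xs k →
                 ∑ f (sublists (x ∷ xs) (suc k))
                   ≡ ∑ (f ∘ (x ∷_)) (sublists xs k) + ∑ f (sublists xs (suc k))
  ∑-sublists-∷ f x xs k = begin
    ∑ f (sublists (x ∷ xs) (suc k))
      ≡⟨ cong (∑ f) (sublists-∷ x xs k) ⟩
    ∑ f (map (x ∷_) (sublists xs k) ++ sublists xs (suc k))
      ≡⟨ ∑-++ f (map (x ∷_) (sublists xs k)) _ ⟩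
    ∑ f (map (x ∷_) (sublists xs k)) + ∑ f (sublists xs (suc k))
      ≡⟨ cong (_+ _) (∑-map f (x ∷_) (sublists xs k)) ⟩
    ∑ (f ∘ (x ∷_)) (sublists xs k) + ∑ f (sublists xs (suc k)) ∎

  ∑-sublists-filterᵇ : ∀ (c : A → Bool) (f : List A → ℕ) xs k →
                       ∑ (λ S → 𝟙 (all c S) * f S) (sublists xs k) ≡ ∑ f (sublists (filterᵇ c xs) k)
  ∑-sublists-filterᵇ c f []       zero    = cong (_+ 0) (*-identityˡ (f []))
  ∑-sublists-filterᵇ c f (x ∷ xs) zero    = cong (_+ 0) (*-identityˡ (f []))
  ∑-sublists-filterᵇ c f []       (suc k) = refl
  ∑-sublists-filterᵇ c f (x ∷ xs) (suc k) = begin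
    ∑ F (sublists (x ∷ xs) (suc k))
      ≡⟨ ∑-sublists-∷ F x xs k ⟩
    ∑ (F ∘ (x ∷_)) (sublists xs k) + ∑ F (sublists xs (suc k))
      ≡⟨ cong₂ _+_ (trans (∑-𝟙-∧ (c x) (all c) (f ∘ (x ∷_)) (sublists xs k))
                          (cong (𝟙 (c x) *_) (∑-sublists-filterᵇ c (f ∘ (x ∷_)) xs k)))
                   (∑-sublists-filterᵇ c f xs (suc k)) ⟩
    𝟙 (c x) * ∑ (f ∘ (x ∷_)) (sublists xs′ k) + ∑ f (sublists xs′ (suc k))
      ≡⟨ keep-or-drop (c x) ⟩
    ∑ f (sublists (if c x then x ∷ xs′ else xs′) (suc k))
      ≡⟨ cong (λ ys → ∑ f (sublists ys (suc k))) (filterᵇ-∷ c x xs) ⟨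
    ∑ f (sublists (filterᵇ c (x ∷ xs)) (suc k)) ∎
    where
    F : List _ → ℕ
    F S = 𝟙 (all c S) * f S
    xs′ : List _
    xs′ = filterᵇ c xs
    keep-or-drop : ∀ b → 𝟙 b * ∑ (f ∘ (x ∷_)) (sublists xs′ k) + ∑ f (sublists xs′ (suc k))
                         ≡ ∑ f (sublists (if b then x ∷ xs′ else xs′) (suc k))
    keep-or-drop true  = trans (cong (_+ _) (*-identityˡ (∑ (f ∘ (x ∷_)) (sublists xs′ k))))
                               (sym (∑-sublists-∷ f x xs′ k))
    keep-or-drop false = refl

  ∑-tuples-filterᵇ : ∀ (c : A → Bool) (f : List A → ℕ) xs k →
                     ∑ (λ t → 𝟙 (all c t) * f t) (tuples xs k) ≡ ∑ f (tuples (filterᵇ c xs) k)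
  ∑-tuples-filterᵇ c f xs zero    = cong (_+ 0) (*-identityˡ (f []))
  ∑-tuples-filterᵇ c f xs (suc k) = begin
    ∑ (λ t → 𝟙 (all c t) * f t) (tuples xs (suc k))
      ≡⟨ ∑-tuples-suc _ xs k ⟩
    ∑ (λ x → ∑ (λ t → 𝟙 (c x ∧ all c t) * f (x ∷ t)) (tuples xs k)) xs
      ≡⟨ ∑-cong (λ x → trans (∑-𝟙-∧ (c x) (all c) (f ∘ (x ∷_)) (tuples xs k))
                             (cong (𝟙 (c x) *_) (∑-tuples-filterᵇ c (f ∘ (x ∷_)) xs k))) xs ⟩
    ∑ (λ x → 𝟙 (c x) * ∑ (f ∘ (x ∷_)) (tuples (filterᵇ c xs) k)) xs
      ≡⟨ ∑-filterᵇ c _ xs ⟨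
    ∑ (λ x → ∑ (f ∘ (x ∷_)) (tuples (filterᵇ c xs) k)) (filterᵇ c xs)
      ≡⟨ ∑-tuples-suc f (filterᵇ c xs) k ⟨
    ∑ f (tuples (filterᵇ c xs) (suc k)) ∎

  length-filter-≟true : ∀ (P : A → Bool) xs → length (filter (λ x → P x ≟ true) xs) ≡ ∑ (𝟙 ∘ P) xs
  length-filter-≟true P []       = refl
  length-filter-≟true P (x ∷ xs) with P x
  ... | true  = cong suc (length-filter-≟true P xs)
  ... | false = length-filter-≟true P xs

  countCliques-∑ : ∀ (a : V → V → Bool) vs k →
                   countCliques a vs k ≡ ∑ (𝟙 ∘ pairwiseAdj a) (sublists vs k)
  countCliques-∑ a vs k = length-filter-≟true (pairwiseAdj a) (sublists vs k)

  countCliques-∷ : ∀ (a : V → V → Bool) y ys k →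
                   countCliques a (y ∷ ys) (suc k)
                     ≡ countCliques a (filterᵇ (a y) ys) k + countCliques a ys (suc k)
  countCliques-∷ a y ys k = begin
    countCliques a (y ∷ ys) (suc k)
      ≡⟨ countCliques-∑ a (y ∷ ys) (suc k) ⟩
    ∑ P (sublists (y ∷ ys) (suc k))
      ≡⟨ ∑-sublists-∷ P y ys k ⟩
    ∑ (λ S → 𝟙 (all (a y) S ∧ pairwiseAdj a S)) (sublists ys k) + ∑ P (sublists ys (suc k))
      ≡⟨ cong (_+ ∑ P (sublists ys (suc k)))
              (trans (∑-cong (λ S → 𝟙-∧ (all (a y) S) (pairwiseAdj a S)) (sublists ys k))
                     (∑-sublists-filterᵇ (a y) P ys k)) ⟩
    ∑ P (sublists (filterᵇ (a y) ys) k) + ∑ P (sublists ys (suc k))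
      ≡⟨ cong₂ _+_ (countCliques-∑ a (filterᵇ (a y) ys) k) (countCliques-∑ a ys (suc k)) ⟨
    countCliques a (filterᵇ (a y) ys) k + countCliques a ys (suc k) ∎
    where
    P : List _ → ℕ
    P = 𝟙 ∘ pairwiseAdj a

  countCliques-filterᵇ-∷ : ∀ (a : V → V → Bool) c y ys k →
    countCliques a (filterᵇ c (y ∷ ys)) (suc k)
      ≡ countCliques a (filterᵇ c ys) (suc k) + 𝟙 (c y) * countCliques a (filterᵇ (a y) (filterᵇ c ys)) k
  countCliques-filterᵇ-∷ a c y ys k with c y
  ... | true  = begin
    countCliques a (y ∷ L) (suc k)                      ≡⟨ countCliques-∷ a y L k ⟩
    countCliques a L′ k + countCliques a L (suc k)      ≡⟨ +-comm (countCliques a L′ k) _ ⟩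
    countCliques a L (suc k) + countCliques a L′ k      ≡⟨ cong (_ +_) (*-identityˡ (countCliques a L′ k)) ⟨
    countCliques a L (suc k) + 1 * countCliques a L′ k  ∎
    where
    L L′ : List _
    L  = filterᵇ c ys
    L′ = filterᵇ (a y) L
  ... | false = sym (+-identityʳ (countCliques a (filterᵇ c ys) (suc k)))

  record Simple (a : V → V → Bool) : Set where
    field
      irreflexive : ∀ x → a x x ≡ false
      symmetric   : ∀ x y → a x y ≡ a y x

  -- Tuples with a repeated vertex are never pairwise adjacent once `a` is irreflexive.
  countOrderedCliques : (V → V → Bool) → List V → ℕ → ℕ
  countOrderedCliques a vs k = ∑ (𝟙 ∘ pairwiseAdj a) (tuples vs k)

  module _ {a : V → V → Bool} (simple : Simple a) where

    open Simple simple

    countCliques-double : ∀ k vs →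
      suc k * countCliques a vs (suc k) ≡ ∑ (λ x → countCliques a (filterᵇ (a x) vs) k) vs
    countCliques-double k         []       = *-zeroʳ (suc k)
    countCliques-double zero      (y ∷ ys) = cong suc (countCliques-double zero ys)
    countCliques-double k@(suc j) (y ∷ ys) = begin
      suc k * countCliques a (y ∷ ys) (suc k)
        ≡⟨ cong (suc k *_) (countCliques-∷ a y ys k) ⟩
      suc k * (cy + countCliques a ys (suc k))
        ≡⟨ *-distribˡ-+ (suc k) cy _ ⟩
      (cy + k * cy) + suc k * countCliques a ys (suc k)
        ≡⟨ cong₂ (λ m n → (cy + m) + n) k*cy≡∑newCliques (countCliques-double k ys) ⟩
      (cy + ∑ newCliques ys) + ∑ (λ x → countCliques a (N x) k) ys
        ≡⟨ +-assoc cy _ _ ⟩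
      cy + (∑ newCliques ys + ∑ (λ x → countCliques a (N x) k) ys)
        ≡⟨ cong (cy +_) (trans (+-comm (∑ newCliques ys) _)
                               (sym (∑-+ (λ x → countCliques a (N x) k) newCliques ys))) ⟩
      cy + ∑ (λ x → countCliques a (N x) k + newCliques x) ys
        ≡⟨ cong₂ _+_ (cong (λ L → countCliques a L k) y∉N[y])
                     (∑-cong (λ x → countCliques-filterᵇ-∷ a (a x) y ys j) ys) ⟨
      countCliques a (filterᵇ (a y) (y ∷ ys)) k + ∑ (λ x → countCliques a (filterᵇ (a x) (y ∷ ys)) k) ys ∎
      where
      N : _ → List _
      N x = filterᵇ (a x) ys
      cy : ℕ
      cy = countCliques a (N y) k
      -- the k-cliques in the neighbourhood of x that appear once y is added to ys
      newCliques : _ → ℕ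
      newCliques x = 𝟙 (a x y) * countCliques a (filterᵇ (a y) (N x)) j
      y∉N[y] : filterᵇ (a y) (y ∷ ys) ≡ N y
      y∉N[y] = trans (filterᵇ-∷ (a y) y ys) (cong (λ b → if b then y ∷ N y else N y) (irreflexive y))
      k*cy≡∑newCliques : k * cy ≡ ∑ newCliques ys
      k*cy≡∑newCliques = begin
        k * countCliques a (N y) k                                     ≡⟨ countCliques-double j (N y) ⟩
        ∑ (λ x → countCliques a (filterᵇ (a x) (N y)) j) (N y)         ≡⟨ ∑-filterᵇ (a y) _ ys ⟩
        ∑ (λ x → 𝟙 (a y x) * countCliques a (filterᵇ (a x) (N y)) j) ys
          ≡⟨ ∑-cong (λ x → cong₂ (λ b L → 𝟙 b * countCliques a L j)
                                 (symmetric y x) (filterᵇ-comm (a x) (a y) ys)) ys ⟩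
        ∑ newCliques ys                                                ∎

    countOrderedCliques≡k!*countCliques : ∀ k vs → countOrderedCliques a vs k ≡ k ! * countCliques a vs k
    countOrderedCliques≡k!*countCliques zero    vs = refl
    countOrderedCliques≡k!*countCliques (suc k) vs = begin
      countOrderedCliques a vs (suc k)
        ≡⟨ ∑-tuples-suc P vs k ⟩
      ∑ (λ x → ∑ (λ t → 𝟙 (all (a x) t ∧ pairwiseAdj a t)) (tuples vs k)) vs
        ≡⟨ ∑-cong (λ x → trans (∑-cong (λ t → 𝟙-∧ (all (a x) t) (pairwiseAdj a t)) (tuples vs k))
                               (∑-tuples-filterᵇ (a x) P vs k)) vs ⟩
      ∑ (λ x → countOrderedCliques a (filterᵇ (a x) vs) k) vs
        ≡⟨ ∑-cong (λ x → countOrderedCliques≡k!*countCliques k (filterᵇ (a x) vs)) vs ⟩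
      ∑ (λ x → k ! * countCliques a (filterᵇ (a x) vs) k) vs
        ≡⟨ ∑-*ˡ (k !) _ vs ⟩
      k ! * ∑ (λ x → countCliques a (filterᵇ (a x) vs) k) vs
        ≡⟨ cong (k ! *_) (countCliques-double k vs) ⟨
      k ! * (suc k * countCliques a vs (suc k))
        ≡⟨ x∙yz≈y∙xz (k !) (suc k) _ ⟩
      suc k * (k ! * countCliques a vs (suc k))
        ≡⟨ *-assoc (suc k) (k !) _ ⟨
      suc k ! * countCliques a vs (suc k) ∎
      where
      P : List _ → ℕ
      P = 𝟙 ∘ pairwiseAdj a

  _⊗_ : (V → V → Bool) → (W → W → Bool) → V × W → V × W → Bool
  (a ⊗ b) (x , y) (x′ , y′) = a x x′ ∧ b y y′

  module _ (a : V → V → Bool) (b : W → W → Bool) where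

    all-⊗ : ∀ p t →
            all ((a ⊗ b) p) t ≡ all (a (proj₁ p)) (map proj₁ t) ∧ all (b (proj₂ p)) (map proj₂ t)
    all-⊗ p []      = refl
    all-⊗ p (q ∷ t) = trans (cong ((a ⊗ b) p q ∧_) (all-⊗ p t))
                            (∧-interchange (a (proj₁ p) (proj₁ q)) _ _ _)

    pairwiseAdj-⊗ : ∀ t →
                    pairwiseAdj (a ⊗ b) t ≡ pairwiseAdj a (map proj₁ t) ∧ pairwiseAdj b (map proj₂ t)
    pairwiseAdj-⊗ []      = refl
    pairwiseAdj-⊗ (p ∷ t) = trans (cong₂ _∧_ (all-⊗ p t) (pairwiseAdj-⊗ t))
                                  (∧-interchange (all (a (proj₁ p)) (map proj₁ t)) _ _ _)

    countOrderedCliques-⊗ : ∀ xs ys k →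
      countOrderedCliques (a ⊗ b) (cartesianProduct xs ys) k
        ≡ countOrderedCliques a xs k * countOrderedCliques b ys k
    countOrderedCliques-⊗ xs ys k =
      trans (∑-cong (λ t → trans (cong 𝟙 (pairwiseAdj-⊗ t)) (𝟙-∧ (pairwiseAdj a (map proj₁ t)) _))
                    (tuples (cartesianProduct xs ys) k))
            (∑-tuples-cartesianProduct (𝟙 ∘ pairwiseAdj a) (𝟙 ∘ pairwiseAdj b) xs ys k)

  ⊗-simple : {a : V → V → Bool} {b : W → W → Bool} → Simple a → Simple b → Simple (a ⊗ b)
  ⊗-simple {a = a} {b} sa sb = record
    { irreflexive = λ (x , y) → cong (_∧ b y y) (Simple.irreflexive sa x)
    ; symmetric   = λ (x , y) (x′ , y′) → cong₂ _∧_ (Simple.symmetric sa x x′) (Simple.symmetric sb y y′)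
    }

  countCliques-⊗ : {a : V → V → Bool} {b : W → W → Bool} → Simple a → Simple b → ∀ xs ys k →
    countCliques (a ⊗ b) (cartesianProduct xs ys) k ≡ k ! * (countCliques a xs k * countCliques b ys k)
  countCliques-⊗ {a = a} {b} sa sb xs ys k = *-cancelˡ-≡ _ _ (k !) {{k !≢0}} (begin
    k ! * countCliques (a ⊗ b) (cartesianProduct xs ys) k
      ≡⟨ countOrderedCliques≡k!*countCliques (⊗-simple sa sb) k (cartesianProduct xs ys) ⟨
    countOrderedCliques (a ⊗ b) (cartesianProduct xs ys) k
      ≡⟨ countOrderedCliques-⊗ a b xs ys k ⟩
    countOrderedCliques a xs k * countOrderedCliques b ys k
      ≡⟨ cong₂ _*_ (countOrderedCliques≡k!*countCliques sa k xs)
                   (countOrderedCliques≡k!*countCliques sb k ys) ⟩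
    (k ! * countCliques a xs k) * (k ! * countCliques b ys k)
      ≡⟨ *-interchange (k !) (countCliques a xs k) (k !) (countCliques b ys k) ⟩
    (k ! * k !) * (countCliques a xs k * countCliques b ys k)
      ≡⟨ *-assoc (k !) (k !) _ ⟩
    k ! * (k ! * (countCliques a xs k * countCliques b ys k)) ∎)

  all-map : ∀ (c : V → Bool) (f : A → V) xs → all c (map f xs) ≡ all (c ∘ f) xs
  all-map c f xs = cong and (sym (map-∘ xs))

  pairwiseAdj-map : ∀ (a : V → V → Bool) (f : A → V) xs →
                    pairwiseAdj a (map f xs) ≡ pairwiseAdj (λ x y → a (f x) (f y)) xs
  pairwiseAdj-map a f []       = refl
  pairwiseAdj-map a f (x ∷ xs) = cong₂ _∧_ (all-map (a (f x)) f xs) (pairwiseAdj-map a f xs)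

  adj-simple : ∀ {n} (g : Graph n) → Simple (adj g)
  adj-simple g = record { irreflexive = irreflexive g ; symmetric = symmetric g }
    where
    irreflexive : ∀ {n} (g : Graph n) i → adj g i i ≡ false
    irreflexive (r , g) zero    = refl
    irreflexive (r , g) (suc i) = irreflexive g i
    symmetric : ∀ {n} (g : Graph n) i j → adj g i j ≡ adj g j i
    symmetric (r , g) zero    zero    = refl
    symmetric (r , g) zero    (suc j) = refl
    symmetric (r , g) (suc i) zero    = refl
    symmetric (r , g) (suc i) (suc j) = symmetric g i j

  Z≡k!*X*X : ∀ {n} k (g h : Graph n) → Z k g h ≡ k ! * (X k g * X k h)
  Z≡k!*X*X {n} k g h = countCliques-⊗ (adj-simple g) (adj-simple h) (allFin n) (allFin n) k

module ErdősRényi where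

  open import Algebra.Bundles using (CommutativeRing)
  open import Data.Bool using (Bool; true; false; _∧_)
  open import Data.Bool.ListAction using (all)
  open import Data.Fin using (Fin; zero; suc)
  open import Data.List using (List; []; _∷_; map; length; allFin)
  open import Data.List.Properties using (map-cong; concatMap-cong; length-tabulate)
  open import Data.List.Relation.Unary.All as All using (All; []; _∷_)
  open import Data.Nat using (ℕ; zero; suc; _∸_) renaming (_+_ to _+ℕ_; _*_ to _*ℕ_)
  open import Data.Nat.Combinatorics using (_C_; nC1≡n; nCk+nC[k+1]≡[n+1]C[k+1])
  import Data.Nat.Properties as ℕ
  import Data.Integer as ℤ
  import Data.Integer.Properties as ℤ
  open import Data.Nat.Coprimality using (1-coprimeTo) renaming (sym to coprime-sym)
  open import Data.Product using (_,_)
  open import Data.Rational using (ℚ; mkℚ; 0ℚ; 1ℚ; _+_; _*_; _-_; _/_)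
  open import Data.Rational.Properties
    using (+-*-commutativeRing; normalize-coprime; +-identityʳ; *-identityˡ; *-zeroˡ; *-assoc; *-distribʳ-+)
  open import Data.Rational.Solver using (module +-*-Solver)
  open import Data.Vec using (Vec; _∷_; lookup)
  open import Function using (_∘_)
  open import Relation.Binary.PropositionalEquality
  open ≡-Reasoning

  open Lists
  open Cliques
  open ListSum (CommutativeRing.commutativeSemiring +-*-commutativeRing)
  module ℕ∑ = ListSum ℕ.+-*-commutativeSemiring
  open import Algebra.Properties.CommutativeSemigroup ℕ.+-commutativeSemigroup
    using () renaming (interchange to +-interchange)

  private variable
    A : Set

  -- On denominator-1 arguments, ℚ's _+_ and _*_ compute to the integer sum and product `/ 1`.
  ℕ→ℚ≡mkℚ : ∀ n → ℕ→ℚ n ≡ mkℚ (ℤ.+ n) 0 (coprime-sym (1-coprimeTo n))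
  ℕ→ℚ≡mkℚ n = normalize-coprime (coprime-sym (1-coprimeTo n))

  ℕ→ℚ-+ : ∀ m n → ℕ→ℚ (m +ℕ n) ≡ ℕ→ℚ m + ℕ→ℚ n
  ℕ→ℚ-+ m n = sym (begin
    ℕ→ℚ m + ℕ→ℚ n
      ≡⟨ cong₂ _+_ (ℕ→ℚ≡mkℚ m) (ℕ→ℚ≡mkℚ n) ⟩
    (ℤ.+ m ℤ.* ℤ.+ 1 ℤ.+ ℤ.+ n ℤ.* ℤ.+ 1) / 1
      ≡⟨ cong (_/ 1) (cong₂ ℤ._+_ (ℤ.*-identityʳ (ℤ.+ m)) (ℤ.*-identityʳ (ℤ.+ n))) ⟩
    (ℤ.+ m ℤ.+ ℤ.+ n) / 1
      ≡⟨ cong (_/ 1) (ℤ.pos-+ m n) ⟨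
    ℕ→ℚ (m +ℕ n) ∎)

  ℕ→ℚ-* : ∀ m n → ℕ→ℚ (m *ℕ n) ≡ ℕ→ℚ m * ℕ→ℚ n
  ℕ→ℚ-* m n = sym (begin
    ℕ→ℚ m * ℕ→ℚ n           ≡⟨ cong₂ _*_ (ℕ→ℚ≡mkℚ m) (ℕ→ℚ≡mkℚ n) ⟩
    (ℤ.+ m ℤ.* ℤ.+ n) / 1   ≡⟨ cong (_/ 1) (ℤ.pos-* m n) ⟨
    ℕ→ℚ (m *ℕ n)            ∎)

  ℕ→ℚ-∑ : ∀ (f : A → ℕ) xs → ℕ→ℚ (ℕ∑.∑ f xs) ≡ ∑ (ℕ→ℚ ∘ f) xs
  ℕ→ℚ-∑ f []       = refl
  ℕ→ℚ-∑ f (x ∷ xs) = trans (ℕ→ℚ-+ (f x) (ℕ∑.∑ f xs)) (cong (ℕ→ℚ (f x) +_) (ℕ→ℚ-∑ f xs))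

  ^ℚ-+ : ∀ x m n → x ^ℚ (m +ℕ n) ≡ x ^ℚ m * x ^ℚ n
  ^ℚ-+ x zero    n = sym (*-identityˡ (x ^ℚ n))
  ^ℚ-+ x (suc m) n = trans (cong (x *_) (^ℚ-+ x m n)) (sym (*-assoc x (x ^ℚ m) (x ^ℚ n)))

  ∑-const : ∀ {f : A → ℚ} {c} xs → All (λ x → f x ≡ c) xs → ∑ f xs ≡ ℕ→ℚ (length xs) * c
  ∑-const {c = c} []       []           = sym (*-zeroˡ c)
  ∑-const {f = f} {c} (x ∷ xs) (fx≡c ∷ fxs≡c) = begin
    f x + ∑ f xs                          ≡⟨ cong₂ _+_ fx≡c (∑-const xs fxs≡c) ⟩
    c + ℕ→ℚ (length xs) * c               ≡⟨ cong (_+ ℕ→ℚ (length xs) * c) (*-identityˡ c) ⟨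
    1ℚ * c + ℕ→ℚ (length xs) * c          ≡⟨ *-distribʳ-+ c 1ℚ (ℕ→ℚ (length xs)) ⟨
    (1ℚ + ℕ→ℚ (length xs)) * c            ≡⟨ cong (_* c) (ℕ→ℚ-+ 1 (length xs)) ⟨
    ℕ→ℚ (suc (length xs)) * c             ∎

  𝔼row : ℚ → (n : ℕ) → (Vec Bool n → ℚ) → ℚ
  𝔼row p n f = ∑ (λ r → rowWeight p r * f r) (allVecs n)

  module _ (p : ℚ) where

    open +-*-Solver

    𝔼row-suc : ∀ n (f : Vec Bool (suc n) → ℚ) →
               𝔼row p (suc n) f ≡ p * 𝔼row p n (f ∘ (true ∷_)) + (1ℚ - p) * 𝔼row p n (f ∘ (false ∷_))
    𝔼row-suc n f = begin
      𝔼row p (suc n) f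
        ≡⟨ ∑-concatMap _ _ (allVecs n) ⟩
      ∑ (λ v → p * w v * f (true ∷ v) + ((1ℚ - p) * w v * f (false ∷ v) + 0ℚ)) (allVecs n)
        ≡⟨ ∑-cong (λ v → cong₂ _+_ (*-assoc p (w v) _)
                                   (trans (+-identityʳ _) (*-assoc (1ℚ - p) (w v) _))) (allVecs n) ⟩
      ∑ (λ v → p * (w v * f (true ∷ v)) + (1ℚ - p) * (w v * f (false ∷ v))) (allVecs n)
        ≡⟨ ∑-+ _ _ (allVecs n) ⟩
      ∑ (λ v → p * (w v * f (true ∷ v))) (allVecs n)
        + ∑ (λ v → (1ℚ - p) * (w v * f (false ∷ v))) (allVecs n)
        ≡⟨ cong₂ _+_ (∑-*ˡ p _ (allVecs n)) (∑-*ˡ (1ℚ - p) _ (allVecs n)) ⟩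
      p * 𝔼row p n (f ∘ (true ∷_)) + (1ℚ - p) * 𝔼row p n (f ∘ (false ∷_)) ∎
      where
      w : Vec Bool n → ℚ
      w = rowWeight p

    𝔼row-cong : ∀ n {f g : Vec Bool n → ℚ} → (∀ r → f r ≡ g r) → 𝔼row p n f ≡ 𝔼row p n g
    𝔼row-cong n f≡g = ∑-cong (λ r → cong (rowWeight p r *_) (f≡g r)) (allVecs n)

    𝔼row-ignoring-head : ∀ n (F : Vec Bool (suc n) → ℚ) f →
                         (∀ b v → F (b ∷ v) ≡ f v) → 𝔼row p (suc n) F ≡ 𝔼row p n f
    𝔼row-ignoring-head n F f F≡f = begin
      𝔼row p (suc n) F
        ≡⟨ 𝔼row-suc n F ⟩
      p * 𝔼row p n (F ∘ (true ∷_)) + (1ℚ - p) * 𝔼row p n (F ∘ (false ∷_))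
        ≡⟨ cong₂ (λ e e′ → p * e + (1ℚ - p) * e′) (𝔼row-cong n (F≡f true))
                                                  (𝔼row-cong n (F≡f false)) ⟩
      p * 𝔼row p n f + (1ℚ - p) * 𝔼row p n f
        ≡⟨ solve 2 (λ p e → p :* e :+ (con 1ℚ :- p) :* e := e) refl p (𝔼row p n f) ⟩
      𝔼row p n f ∎

    𝔼row-const : ∀ n c → 𝔼row p n (λ _ → c) ≡ c
    𝔼row-const zero    c = trans (+-identityʳ (1ℚ * c)) (*-identityˡ c)
    𝔼row-const (suc n) c = trans (𝔼row-ignoring-head n _ _ (λ _ _ → refl)) (𝔼row-const n c)

    𝔼row-head-true : ∀ n (F : Vec Bool (suc n) → ℚ) f →
                     (∀ v → F (true ∷ v) ≡ f v) → (∀ v → F (false ∷ v) ≡ 0ℚ) →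
                     𝔼row p (suc n) F ≡ p * 𝔼row p n f
    𝔼row-head-true n F f F[1]≡f F[0]≡0 = begin
      𝔼row p (suc n) F
        ≡⟨ 𝔼row-suc n F ⟩
      p * 𝔼row p n (F ∘ (true ∷_)) + (1ℚ - p) * 𝔼row p n (F ∘ (false ∷_))
        ≡⟨ cong₂ (λ e e′ → p * e + (1ℚ - p) * e′) (𝔼row-cong n F[1]≡f)
                                                  (trans (𝔼row-cong n F[0]≡0) (𝔼row-const n 0ℚ)) ⟩
      p * 𝔼row p n f + (1ℚ - p) * 0ℚ
        ≡⟨ solve 2 (λ p e → p :* e :+ (con 1ℚ :- p) :* con 0ℚ := p :* e) refl p (𝔼row p n f) ⟩
      p * 𝔼row p n f ∎

    𝔼₁-cong : ∀ n {f g : Graph n → ℚ} → (∀ G → f G ≡ g G) → 𝔼₁ p n f ≡ 𝔼₁ p n g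
    𝔼₁-cong n f≡g = ∑-cong (λ G → cong (prob p G *_) (f≡g G)) (allGraphs n)

    𝔼₁-suc : ∀ n (f : Vec Bool n → ℚ) (h : Graph n → ℚ) →
             𝔼₁ p (suc n) (λ (r , G) → f r * h G) ≡ 𝔼row p n f * 𝔼₁ p n h
    𝔼₁-suc n f h = begin
      𝔼₁ p (suc n) (λ (r , G) → f r * h G)
        ≡⟨ ∑-concatMap _ _ (allVecs n) ⟩
      ∑ (λ r → ∑ (λ (r , G) → rowWeight p r * prob p G * (f r * h G)) (map (r ,_) (allGraphs n))) (allVecs n)
        ≡⟨ ∑-cong (λ r → ∑-map _ (r ,_) (allGraphs n)) (allVecs n) ⟩
      ∑ (λ r → ∑ (λ G → rowWeight p r * prob p G * (f r * h G)) (allGraphs n)) (allVecs n)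
        ≡⟨ ∑-cong (λ r → ∑-cong (λ G → regroup (rowWeight p r) (prob p G) (f r) (h G)) (allGraphs n)) (allVecs n) ⟩
      ∑ (λ r → ∑ (λ G → (rowWeight p r * f r) * (prob p G * h G)) (allGraphs n)) (allVecs n)
        ≡⟨ ∑-*-∑ _ _ (allVecs n) (allGraphs n) ⟩
      𝔼row p n f * 𝔼₁ p n h ∎
      where
      regroup : ∀ w q x y → w * q * (x * y) ≡ (w * x) * (q * y)
      regroup = solve 4 (λ w q x y → w :* q :* (x :* y) := (w :* x) :* (q :* y)) refl

    𝔼₁-const : ∀ n c → 𝔼₁ p n (λ _ → c) ≡ c
    𝔼₁-const zero    c = trans (+-identityʳ (1ℚ * c)) (*-identityˡ c)
    𝔼₁-const (suc n) c = begin
      𝔼₁ p (suc n) (λ _ → c)                    ≡⟨ 𝔼₁-cong (suc n) (λ _ → *-identityˡ c) ⟨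
      𝔼₁ p (suc n) (λ _ → 1ℚ * c)               ≡⟨ 𝔼₁-suc n (λ _ → 1ℚ) (λ _ → c) ⟩
      𝔼row p n (λ _ → 1ℚ) * 𝔼₁ p n (λ _ → c)    ≡⟨ cong₂ _*_ (𝔼row-const n 1ℚ) (𝔼₁-const n c) ⟩
      1ℚ * c                                    ≡⟨ *-identityˡ c ⟩
      c                                         ∎

    𝔼₁-∑ : ∀ n (f : Graph n → A → ℚ) xs →
           𝔼₁ p n (λ G → ∑ (f G) xs) ≡ ∑ (λ x → 𝔼₁ p n (λ G → f G x)) xs
    𝔼₁-∑ n f xs = trans (∑-cong (λ G → sym (∑-*ˡ (prob p G) (f G) xs)) (allGraphs n))
                        (∑-comm _ (allGraphs n) xs)

    𝔼₂-cong : ∀ n {f g : Graph n → Graph n → ℚ} → (∀ G H → f G H ≡ g G H) → 𝔼₂ p n f ≡ 𝔼₂ p n g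
    𝔼₂-cong n f≡g = cong sum (concatMap-cong (λ G → map-cong (λ H → cong (prob p G * prob p H *_) (f≡g G H))
                                                            (allGraphs n))
                                             (allGraphs n))

    Var₂-cong : ∀ n {f g : Graph n → Graph n → ℚ} → (∀ G H → f G H ≡ g G H) → Var₂ p n f ≡ Var₂ p n g
    Var₂-cong n f≡g = cong₂ _-_ (𝔼₂-cong n (λ G H → cong₂ _*_ (f≡g G H) (f≡g G H)))
                                (cong₂ _*_ (𝔼₂-cong n f≡g) (𝔼₂-cong n f≡g))

    𝔼₂-scaled-product : ∀ n c (f g : Graph n → ℚ) →
                        𝔼₂ p n (λ G H → c * (f G * g H)) ≡ c * (𝔼₁ p n f * 𝔼₁ p n g)
    𝔼₂-scaled-product n c f g = begin
      𝔼₂ p n (λ G H → c * (f G * g H))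
        ≡⟨ sum-concatMap _ (allGraphs n) ⟩
      ∑ (λ G → ∑ (λ H → prob p G * prob p H * (c * (f G * g H))) (allGraphs n)) (allGraphs n)
        ≡⟨ ∑-cong (λ G → ∑-cong (λ H → regroup (prob p G) (prob p H) (f G) (g H)) (allGraphs n)) (allGraphs n) ⟩
      ∑ (λ G → ∑ (λ H → (c * (prob p G * f G)) * (prob p H * g H)) (allGraphs n)) (allGraphs n)
        ≡⟨ ∑-*-∑ _ _ (allGraphs n) (allGraphs n) ⟩
      ∑ (λ G → c * (prob p G * f G)) (allGraphs n) * 𝔼₁ p n g
        ≡⟨ cong (_* 𝔼₁ p n g) (∑-*ˡ c _ (allGraphs n)) ⟩
      c * 𝔼₁ p n f * 𝔼₁ p n g
        ≡⟨ *-assoc c _ _ ⟩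
      c * (𝔼₁ p n f * 𝔼₁ p n g) ∎
      where
      regroup : ∀ P Q x y → P * Q * (c * (x * y)) ≡ (c * (P * x)) * (Q * y)
      regroup = solve 5 (λ c P Q x y → P :* Q :* (c :* (x :* y)) := (c :* (P :* x)) :* (Q :* y)) refl c

    Var₂-scaled-product : ∀ n c (f : Graph n → ℚ) → Var₂ p n (λ G H → c * (f G * f H))
      ≡ (c * c) * (Var₁ p n f * Var₁ p n f + ℕ→ℚ 2 * Var₁ p n f * (𝔼₁ p n f * 𝔼₁ p n f))
    Var₂-scaled-product n c f = begin
      Var₂ p n (λ G H → c * (f G * f H))
        ≡⟨ cong₂ _-_ (trans (𝔼₂-cong n (λ G H → square c (f G) (f H))) (𝔼₂-scaled-product n (c * c) f² f²))
                     (cong₂ _*_ (𝔼₂-scaled-product n c f f) (𝔼₂-scaled-product n c f f)) ⟩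
      (c * c) * (s * s) - (c * (m * m)) * (c * (m * m))
        ≡⟨ solve 3 (λ c s m → (c :* c) :* (s :* s) :- (c :* (m :* m)) :* (c :* (m :* m))
                             := (c :* c) :* ((s :- m :* m) :* (s :- m :* m)
                                              :+ (con 1ℚ :+ con 1ℚ) :* (s :- m :* m) :* (m :* m)))
                   refl c s m ⟩
      (c * c) * (Var₁ p n f * Var₁ p n f + ℕ→ℚ 2 * Var₁ p n f * (𝔼₁ p n f * 𝔼₁ p n f)) ∎
      where
      f² : Graph n → ℚ
      f² G = f G * f G
      m s : ℚ
      m = 𝔼₁ p n f
      s = 𝔼₁ p n f²
      square : ∀ c x y → c * (x * y) * (c * (x * y)) ≡ (c * c) * ((x * x) * (y * y))
      square = solve 3 (λ c x y → c :* (x :* y) :* (c :* (x :* y)) := (c :* c) :* ((x :* x) :* (y :* y))) refl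

  [1+n]C2≡n+nC2 : ∀ n → suc n C 2 ≡ n +ℕ n C 2
  [1+n]C2≡n+nC2 n = trans (sym (nCk+nC[k+1]≡[n+1]C[k+1] n 1)) (cong (_+ℕ n C 2) (nC1≡n n))

  n*[n∸1]≡nC2+nC2 : ∀ n → n *ℕ (n ∸ 1) ≡ n C 2 +ℕ n C 2
  n*[n∸1]≡nC2+nC2 zero    = refl
  n*[n∸1]≡nC2+nC2 (suc n) = begin
    n +ℕ n *ℕ n                        ≡⟨ cong (n +ℕ_) (n*n≡n+n*[n∸1] n) ⟩
    n +ℕ (n +ℕ n *ℕ (n ∸ 1))           ≡⟨ cong (λ m → n +ℕ (n +ℕ m)) (n*[n∸1]≡nC2+nC2 n) ⟩
    n +ℕ (n +ℕ (n C 2 +ℕ n C 2))       ≡⟨ trans (+-interchange n (n C 2) n (n C 2)) (ℕ.+-assoc n n _) ⟨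
    (n +ℕ n C 2) +ℕ (n +ℕ n C 2)       ≡⟨ cong₂ _+ℕ_ ([1+n]C2≡n+nC2 n) ([1+n]C2≡n+nC2 n) ⟨
    suc n C 2 +ℕ suc n C 2             ∎
    where
    n*n≡n+n*[n∸1] : ∀ n → n *ℕ n ≡ n +ℕ n *ℕ (n ∸ 1)
    n*n≡n+n*[n∸1] zero    = refl
    n*n≡n+n*[n∸1] (suc n) = ℕ.*-suc (suc n) n

  -- r is the adjacency row of an extra vertex put in front of Fin n, as in Graph (suc n).
  𝟙-joined : ∀ {n} → List (Fin n) → Vec Bool n → ℚ
  𝟙-joined S r = ℕ→ℚ (𝟙 (all (lookup r) S))

  𝟙-clique : ∀ {n} → List (Fin n) → Graph n → ℚ
  𝟙-clique S G = ℕ→ℚ (𝟙 (pairwiseAdj (adj G) S))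

  module _ {n} (S : List (Fin n)) where

    𝟙-joined-shift : ∀ b v → 𝟙-joined (map suc S) (b ∷ v) ≡ 𝟙-joined S v
    𝟙-joined-shift b v = cong (ℕ→ℚ ∘ 𝟙) (all-map (lookup (b ∷ v)) suc S)

    𝟙-clique-shift : ∀ r G → 𝟙-clique (map suc S) (r , G) ≡ 𝟙-clique S G
    𝟙-clique-shift r G = cong (ℕ→ℚ ∘ 𝟙) (pairwiseAdj-map (adj (r , G)) suc S)

    𝟙-clique-extend : ∀ r G → 𝟙-clique (zero ∷ map suc S) (r , G) ≡ 𝟙-joined S r * 𝟙-clique S G
    𝟙-clique-extend r G = begin
      ℕ→ℚ (𝟙 (all (adj (r , G) zero) (map suc S) ∧ pairwiseAdj (adj (r , G)) (map suc S)))
        ≡⟨ cong (ℕ→ℚ ∘ 𝟙) (cong₂ _∧_ (all-map (adj (r , G) zero) suc S) (pairwiseAdj-map (adj (r , G)) suc S)) ⟩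
      ℕ→ℚ (𝟙 (all (lookup r) S ∧ pairwiseAdj (adj G) S))
        ≡⟨ cong ℕ→ℚ (𝟙-∧ (all (lookup r) S) _) ⟩
      ℕ→ℚ (𝟙 (all (lookup r) S) *ℕ 𝟙 (pairwiseAdj (adj G) S))
        ≡⟨ ℕ→ℚ-* (𝟙 (all (lookup r) S)) _ ⟩
      𝟙-joined S r * 𝟙-clique S G ∎

  record CliqueLaws (p : ℚ) {n : ℕ} (k : ℕ) (S : List (Fin n)) : Set where
    field
      joined : 𝔼row p n (𝟙-joined S) ≡ p ^ℚ k
      clique : 𝔼₁ p n (𝟙-clique S) ≡ p ^ℚ (k C 2)

  module _ (p : ℚ) where

    CliqueLaws-[] : ∀ {n} → CliqueLaws p {n} 0 []
    CliqueLaws-[] {n} = record { joined = 𝔼row-const p n 1ℚ ; clique = 𝔼₁-const p n 1ℚ }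

    CliqueLaws-shift : ∀ {n k S} → CliqueLaws p {n} k S → CliqueLaws p k (map suc S)
    CliqueLaws-shift {n} {k} {S} laws = record
      { joined = trans (𝔼row-ignoring-head p n _ _ (𝟙-joined-shift S)) joined
      ; clique = begin
          𝔼₁ p (suc n) (𝟙-clique (map suc S))
            ≡⟨ 𝔼₁-cong p (suc n) (λ (r , G) → trans (𝟙-clique-shift S r G) (sym (*-identityˡ _))) ⟩
          𝔼₁ p (suc n) (λ (r , G) → 1ℚ * 𝟙-clique S G)
            ≡⟨ 𝔼₁-suc p n (λ _ → 1ℚ) (𝟙-clique S) ⟩
          𝔼row p n (λ _ → 1ℚ) * 𝔼₁ p n (𝟙-clique S)
            ≡⟨ cong₂ _*_ (𝔼row-const p n 1ℚ) clique ⟩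
          1ℚ * p ^ℚ (k C 2)
            ≡⟨ *-identityˡ _ ⟩
          p ^ℚ (k C 2) ∎
      }
      where open CliqueLaws laws

    CliqueLaws-extend : ∀ {n k S} → CliqueLaws p {n} k S → CliqueLaws p (suc k) (zero ∷ map suc S)
    CliqueLaws-extend {n} {k} {S} laws = record
      { joined = trans (𝔼row-head-true p n _ _ (𝟙-joined-shift S true) (λ _ → refl)) (cong (p *_) joined)
      ; clique = begin
          𝔼₁ p (suc n) (𝟙-clique (zero ∷ map suc S))
            ≡⟨ 𝔼₁-cong p (suc n) (λ (r , G) → 𝟙-clique-extend S r G) ⟩
          𝔼₁ p (suc n) (λ (r , G) → 𝟙-joined S r * 𝟙-clique S G)
            ≡⟨ 𝔼₁-suc p n (𝟙-joined S) (𝟙-clique S) ⟩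
          𝔼row p n (𝟙-joined S) * 𝔼₁ p n (𝟙-clique S)
            ≡⟨ cong₂ _*_ joined clique ⟩
          p ^ℚ k * p ^ℚ (k C 2)
            ≡⟨ ^ℚ-+ p k (k C 2) ⟨
          p ^ℚ (k +ℕ k C 2)
            ≡⟨ cong (p ^ℚ_) ([1+n]C2≡n+nC2 k) ⟨
          p ^ℚ (suc k C 2) ∎
      }
      where open CliqueLaws laws

    cliqueLaws : ∀ n k → All (CliqueLaws p k) (sublists (allFin n) k)
    cliqueLaws = All-sublists-allFin (CliqueLaws p) CliqueLaws-[] CliqueLaws-extend CliqueLaws-shift

    𝔼₁-X : ∀ n k → 𝔼₁ p n (λ G → ℕ→ℚ (X k G)) ≡ ℕ→ℚ (n C k) * p ^ℚ (k C 2)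
    𝔼₁-X n k = begin
      𝔼₁ p n (λ G → ℕ→ℚ (X k G))
        ≡⟨ 𝔼₁-cong p n (λ G → trans (cong ℕ→ℚ (countCliques-∑ (adj G) (allFin n) k)) (ℕ→ℚ-∑ _ k-sets)) ⟩
      𝔼₁ p n (λ G → ∑ (λ S → 𝟙-clique S G) k-sets)
        ≡⟨ 𝔼₁-∑ p n _ k-sets ⟩
      ∑ (λ S → 𝔼₁ p n (𝟙-clique S)) k-sets
        ≡⟨ ∑-const k-sets (All.map CliqueLaws.clique (cliqueLaws n k)) ⟩
      ℕ→ℚ (length k-sets) * p ^ℚ (k C 2)
        ≡⟨ cong (λ m → ℕ→ℚ m * p ^ℚ (k C 2))
                (trans (length-sublists (allFin n) k) (cong (_C k) (length-tabulate (λ i → i)))) ⟩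
      ℕ→ℚ (n C k) * p ^ℚ (k C 2) ∎
      where
      k-sets : List (List (Fin n))
      k-sets = sublists (allFin n) k

open import Data.Nat using (ℕ; _≥_; _!) renaming (_*_ to _*ℕ_; _∸_ to _∸ℕ_)
open import Data.Nat.Combinatorics using (_C_)
open import Data.Rational using (ℚ; 0ℚ; 1ℚ; _<_; _*_; _+_)
open import Data.Product using (_×_; _,_)
open import Data.Rational.Solver using (module +-*-Solver)
open import Relation.Binary.PropositionalEquality using (_≡_; refl; sym; trans; cong; module ≡-Reasoning)
open Cliques using (Z≡k!*X*X)
open ErdősRényi

-- Both identities are polynomial in p and also hold for k = 0.
theorem2p1 : (n : ℕ) (p : ℚ) → 0ℚ < p → p < 1ℚ → (k : ℕ) → k ≥ 1 →
    (𝔼₂ p n (λ g h → ℕ→ℚ (Z k g h))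
       ≡ ℕ→ℚ (k !) * (ℕ→ℚ (n C k) * ℕ→ℚ (n C k)) * (p ^ℚ (k *ℕ (k ∸ℕ 1))))
    × (Var₂ p n (λ g h → ℕ→ℚ (Z k g h))
       ≡ (ℕ→ℚ (k !) * ℕ→ℚ (k !))
         * ((Var₁ p n (λ g → ℕ→ℚ (X k g)) * Var₁ p n (λ g → ℕ→ℚ (X k g)))
            + ℕ→ℚ 2 * Var₁ p n (λ g → ℕ→ℚ (X k g))
                    * (𝔼₁ p n (λ g → ℕ→ℚ (X k g)) * 𝔼₁ p n (λ g → ℕ→ℚ (X k g)))))
theorem2p1 n p _ _ k _ = mean , trans (Var₂-cong p n Z≡c*x*x) (Var₂-scaled-product p n c x)
  where
  open ≡-Reasoning
  open +-*-Solver
  c N q : ℚ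
  c = ℕ→ℚ (k !)
  N = ℕ→ℚ (n C k)
  q = p ^ℚ (k C 2)
  x : Graph n → ℚ
  x G = ℕ→ℚ (X k G)
  Z≡c*x*x : ∀ G H → ℕ→ℚ (Z k G H) ≡ c * (x G * x H)
  Z≡c*x*x G H = trans (cong ℕ→ℚ (Z≡k!*X*X k G H)) (trans (ℕ→ℚ-* (k !) _) (cong (c *_) (ℕ→ℚ-* (X k G) (X k H))))
  q*q≡p^[k*[k∸1]] : q * q ≡ p ^ℚ (k *ℕ (k ∸ℕ 1))
  q*q≡p^[k*[k∸1]] = sym (trans (cong (p ^ℚ_) (n*[n∸1]≡nC2+nC2 k)) (^ℚ-+ p (k C 2) (k C 2)))
  mean : 𝔼₂ p n (λ G H → ℕ→ℚ (Z k G H)) ≡ c * (N * N) * p ^ℚ (k *ℕ (k ∸ℕ 1))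
  mean = begin
    𝔼₂ p n (λ G H → ℕ→ℚ (Z k G H))    ≡⟨ 𝔼₂-cong p n Z≡c*x*x ⟩
    𝔼₂ p n (λ G H → c * (x G * x H))   ≡⟨ 𝔼₂-scaled-product p n c x x ⟩
    c * (𝔼₁ p n x * 𝔼₁ p n x)          ≡⟨ cong (λ m → c * (m * m)) (𝔼₁-X p n k) ⟩
    c * ((N * q) * (N * q))            ≡⟨ solve 3 (λ c N q → c :* ((N :* q) :* (N :* q)) := c :* (N :* N) :* (q :* q))
                                                 refl c N q ⟩
    c * (N * N) * (q * q)              ≡⟨ cong (c * (N * N) *_) q*q≡p^[k*[k∸1]] ⟩
    c * (N * N) * p ^ℚ (k *ℕ (k ∸ℕ 1)) ∎
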